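{- For every digraph $D$, $dG(D)=dc^o(D)$.
   Context: All digraphs are finite, without loops; symmetric arcs (2-cycles) are permitted. A (vertex) coloring of a digraph $D$ is acyclic if each chromatic class induces a subdigraph with no directed cycle. Greedy coloring with respect to an ordering $v_1,\dots,v_n$ of $V(D)$: $v_1$ gets color $1$; if $v_1,\dots,v_j$ have been colored with colors $1,\dots,t-1$ and $V_1,\dots,V_{t-1}$ are the current chromatic classes, then $v_{j+1}$ gets the smallest $i$ such that $V_i\cup\{v_{j+1}\}$ induces an acyclic subdigraph, and gets the new color $t$ if there is no such $i$. The digrundy number $dG(D)$ is the largest number of colors in a greedy coloring of $D$ over all orderings of $V(D)$. For an ordering $\phi: v_1,\dots,v_n$ of $V(D)$, a parsimonious $\phi$-coloring is an acyclic coloring $\varsigma$ obtained by coloring the vertices in the order $\phi$, with $\varsigma(v_1)=1$, such that each vertex $v_{i+1}$ is assigned a color already used on $v_1,\dots,v_i$ whenever possible (i.e. whenever for some existing chromatic class $X$, $X\cup\{v_{i+1}\}$ induces an acyclic subdigraph); if more than one such color is possible, a color is chosen that results in using the fewest number of colors to color $D$; if $v_{i+1}$ forms a directed cycle with every current chromatic class, $v_{i+1}$ gets the smallest positive integer not yet used. The parsimonious $\phi$-coloring number $dc_\phi(D)$ is the minimum number of colors in a parsimonious $\phi$-coloring of $D$, and the diochromatic number $dc^o(D)$ is the maximum of $dc_\phi(D)$ over all orderings $\phi$ of $V(D)$. -}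

module Defs where

open import Data.Nat using (ℕ; zero; suc; _≤_; _<_)
open import Data.Fin using (Fin; inject₁; fromℕ) renaming (zero to fzero; suc to fsuc; _<_ to _<ᶠ_)
open import Data.Fin.Permutation using (Permutation′; _⟨$⟩ʳ_; _⟨$⟩ˡ_)
open import Data.Bool using (Bool; true; false; T)
open import Data.Product using (Σ; _×_; ∃; ∃-syntax)
open import Data.Sum using (_⊎_)
open import Relation.Nullary using (¬_)
open import Relation.Binary.PropositionalEquality using (_≡_; _≢_)
open import Function.Definitions using (Injective)

-- Digraphs: vertex set Fin n, arc relation given by a Boolean adjacency
-- function, no loops.  Symmetric arcs (2-cycles) are allowed.

record Digraph : Set where
  field
    n        : ℕ
    arc      : Fin n → Fin n → Bool
    loopless : ∀ v → arc v v ≡ false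

open Digraph public

Arc : (D : Digraph) → Fin (n D) → Fin (n D) → Set
Arc D u v = T (arc D u v)

VSet : Digraph → Set₁
VSet D = Fin (n D) → Set

record DiCycleIn (D : Digraph) (S : VSet D) : Set where
  field
    k      : ℕ
    w      : Fin (suc (suc k)) → Fin (n D)
    w-inj  : Injective _≡_ _≡_ w
    w-in   : ∀ i → S (w i)
    w-arc  : ∀ (i : Fin (suc k)) → Arc D (w (inject₁ i)) (w (fsuc i))
    w-close : Arc D (w (fromℕ (suc k))) (w fzero)

Acyclic : (D : Digraph) → VSet D → Set
Acyclic D S = ¬ DiCycleIn D S

-- Colorings by positive integers (colors are 1,2,3,…).
Coloring : Digraph → Set
Coloring D = Fin (n D) → ℕ

-- Orderings of V(D): v_j = φ ⟨$⟩ʳ j is the j-th vertex.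
Ordering : Digraph → Set
Ordering D = Permutation′ (n D)

Before : (D : Digraph) → Ordering D → Fin (n D) → Fin (n D) → Set
Before D φ u v = (φ ⟨$⟩ˡ u) <ᶠ (φ ⟨$⟩ˡ v)

ClassPlus : (D : Digraph) → Ordering D → Coloring D → ℕ → Fin (n D) → VSet D
ClassPlus D φ c i v u = (Before D φ u v × c u ≡ i) ⊎ u ≡ v

UsedBefore : (D : Digraph) → Ordering D → Coloring D → ℕ → Fin (n D) → Set
UsedBefore D φ c i v = ∃[ u ] (Before D φ u v × c u ≡ i)

UsesColors : (D : Digraph) → Coloring D → ℕ → Set
UsesColors D c k =
  (∀ v → 1 ≤ c v × c v ≤ k) × (∀ i → 1 ≤ i → i ≤ k → ∃[ v ] c v ≡ i)

-- Greedy coloring w.r.t. φ: each vertex v gets the smallest positive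
-- color i such that V_i ∪ {v} (V_i = current class of i) is acyclic.
-- (A class that is still empty gives {v}, which is acyclic, so this
-- smallest i is either an existing color or the new color t.)

IsGreedy : (D : Digraph) → Ordering D → Coloring D → Set
IsGreedy D φ c = ∀ v →
  1 ≤ c v
  × Acyclic D (ClassPlus D φ c (c v) v)
  × (∀ i → 1 ≤ i → i < c v → ¬ Acyclic D (ClassPlus D φ c i v))

IsDigrundy : Digraph → ℕ → Set
IsDigrundy D k =
  (∃[ φ ] ∃[ c ] (IsGreedy D φ c × UsesColors D c k))
  × (∀ φ c k′ → IsGreedy D φ c → UsesColors D c k′ → k′ ≤ k)

UsableExisting : (D : Digraph) → Ordering D → Coloring D → ℕ → Fin (n D) → Set
UsableExisting D φ c i v =
  UsedBefore D φ c i v × Acyclic D (ClassPlus D φ c i v)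

SmallestUnused : (D : Digraph) → Ordering D → Coloring D → Fin (n D) → Set
SmallestUnused D φ c v =
  1 ≤ c v × ¬ UsedBefore D φ c (c v) v
  × (∀ i → 1 ≤ i → i < c v → UsedBefore D φ c i v)

-- Local parsimony rule: v receives an existing color whenever possible
-- (any usable one), otherwise the smallest unused positive integer.
IsParsimonious : (D : Digraph) → Ordering D → Coloring D → Set
IsParsimonious D φ c = ∀ v →
  UsableExisting D φ c (c v) v
  ⊎ ((∀ i → ¬ UsableExisting D φ c i v) × SmallestUnused D φ c v)

IsParsNumber : (D : Digraph) → Ordering D → ℕ → Set
IsParsNumber D φ k =
  (∃[ c ] (IsParsimonious D φ c × UsesColors D c k))
  × (∀ c k′ → IsParsimonious D φ c → UsesColors D c k′ → k ≤ k′)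

IsDiochromatic : Digraph → ℕ → Set
IsDiochromatic D m =
  (∃[ φ ] IsParsNumber D φ m)
  × (∀ φ k → IsParsNumber D φ k → k ≤ m)

module Submission where

-- Call a coloring g Grundy if its classes are acyclic and every vertex v forms a directed cycle with
-- each class i < g v.  Every greedy coloring is Grundy, and is also a parsimonious coloring for its
-- ordering.  Conversely, if the vertices of a Grundy coloring g are ordered by increasing color, then
-- g is the greedy coloring for that ordering, and by induction along it every parsimonious coloring
-- coincides with g.  So the largest number K of colors of a Grundy coloring is dG(D), and it is also
-- dc°(D): it is attained at that ordering, and for any ordering the parsimonious number is at most
-- the number of colors of the greedy coloring, which is at most K.

open import Defs
open import Data.Nat using (ℕ; zero; suc; _≤_; _<_; _≤?_; _<?_; z≤n; s≤s; _⊔_)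
open import Data.Nat.Properties
  using (≤-refl; ≤-trans; <-trans; <-irrefl; <-asym; ≮⇒≥; <-cmp; ≤-antisym; ≤-reflexive;
         n≤1+n; ≤-pred; suc-injective; m≤n⇒m<n∨m≡n; <⇒≢; ≤∧≢⇒<; m≤m⊔n; m≤n⊔m; ⊔-sel; <⇒≱;
         anyUpTo?; allUpTo?)
  renaming (_≟_ to _≟ℕ_)
open import Data.Fin using (Fin; inject₁; fromℕ; toℕ; fromℕ<; punchOut)
  renaming (zero to fzero; suc to fsuc; _<_ to _<ᶠ_)
open import Data.Fin.Induction using (<-wellFounded)
open import Data.Fin.Permutation using (_⟨$⟩ʳ_; _⟨$⟩ˡ_; permutation; inverseʳ)
import Data.Fin.Permutation as Perm
open import Data.Fin.Properties
  using (any?; all?; toℕ-injective; toℕ<n; toℕ-fromℕ<; injective⇒≤; punchOut-injective)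
  renaming (_≟_ to _≟ᶠ_)
open import Data.Vec using (Vec; []; _∷_; lookup; tabulate)
open import Data.Vec.Properties using (lookup∘tabulate; []=⇒lookup; lookup⇒[]=)
open import Data.Fin.Subset using (Subset; _∈_; ∣_∣)
open import Data.Fin.Subset.Properties using (∈⊤; ∣⊤∣≡n; p⊂q⇒∣p∣<∣q∣)
open import Data.Product using (Σ; _×_; _,_; proj₁; proj₂; ∃; ∃-syntax)
open import Data.Sum using (_⊎_; inj₁; inj₂)
open import Function using (_∘_)
open import Function.Definitions using (Injective)
open import Relation.Nullary using (¬_; Dec; yes; no; contradiction)
open import Relation.Nullary.Decidable
  using (map′; _×-dec_; _⊎-dec_; _→-dec_; ¬?; T?; does; dec-true; dec-false; decidable-stable)
open import Relation.Unary using (Decidable; _⊆_)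
open import Relation.Binary.Definitions using (tri<; tri≈; tri>)
open import Relation.Binary.Construct.On as On using ()
open import Induction.WellFounded using (WellFounded; module All)
open import Level using (0ℓ)
open import Relation.Binary.PropositionalEquality
  using (_≡_; _≢_; _≗_; refl; sym; trans; cong; subst; subst₂)

any-Vec? : ∀ {k} m {P : Vec (Fin k) m → Set} → Decidable P → Dec (∃ P)
any-Vec? zero P? = map′ ([] ,_) (λ { ([] , p) → p }) (P? [])
any-Vec? (suc m) P? =
  map′ (λ { (x , xs , p) → x ∷ xs , p }) (λ { (x ∷ xs , p) → x , xs , p })
       (any? λ x → any-Vec? m (P? ∘ (x ∷_)))

least-witness : {P : ℕ → Set} → Decidable P → ∀ b → P b →
                ∃[ i ] (P i × ∀ {j} → j < i → ¬ P j)
least-witness P? zero p = zero , p , λ ()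
least-witness P? (suc b) p with P? zero | least-witness (P? ∘ suc) b p
... | yes p₀ | _ = zero , p₀ , λ ()
... | no ¬p₀ | i , pᵢ , least = suc i , pᵢ , λ { {zero} _ → ¬p₀ ; {suc j} (s≤s j<i) → least j<i }

greatest-witness : {Q : ℕ → Set} → Decidable Q → ∀ b {k} → k ≤ b → Q k →
                   ∃[ K ] (Q K × ∀ {k′} → k′ ≤ b → Q k′ → k′ ≤ K)
greatest-witness Q? zero z≤n q = zero , q , λ k′≤0 _ → k′≤0
greatest-witness {Q} Q? (suc b) k≤1+b q with Q? (suc b)
... | yes q₁₊b = suc b , q₁₊b , λ k′≤1+b _ → k′≤1+b
... | no ¬q₁₊b =
  let K , qK , greatest = greatest-witness Q? b (≤b k≤1+b q) q
  in K , qK , λ k′≤1+b q′ → greatest (≤b k′≤1+b q′) q′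
  where
  ≤b : ∀ {k} → k ≤ suc b → Q k → k ≤ b
  ≤b k≤1+b q = ≤-pred (≤∧≢⇒< k≤1+b λ { refl → ¬q₁₊b q })

maximum : ∀ {m} → (Fin m → ℕ) → ℕ
maximum {zero} f = 0
maximum {suc m} f = f fzero ⊔ maximum (f ∘ fsuc)

≤-maximum : ∀ {m} (f : Fin m → ℕ) x → f x ≤ maximum f
≤-maximum f fzero = m≤m⊔n _ _
≤-maximum f (fsuc x) = ≤-trans (≤-maximum (f ∘ fsuc) x) (m≤n⊔m _ _)

maximum-attained : ∀ {m} (f : Fin m → ℕ) → 0 < maximum f → ∃[ x ] f x ≡ maximum f
maximum-attained {suc m} f 0<max with ⊔-sel (f fzero) (maximum (f ∘ fsuc))
... | inj₁ eq = fzero , sym eq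
... | inj₂ eq with maximum-attained (f ∘ fsuc) (subst (0 <_) eq 0<max)
...   | x , fx≡max = fsuc x , trans fx≡max (sym eq)

argmax : ∀ {m} (f : Fin (suc m) → ℕ) → ∃[ a ] (∀ b → f b ≤ f a)
argmax f with 0 <? maximum f
... | no 0≮max = fzero , λ b → ≤-trans (≤-trans (≤-maximum f b) (≮⇒≥ 0≮max)) z≤n
... | yes 0<max with maximum-attained f 0<max
...   | a , fa≡max = a , λ b → subst (f b ≤_) (sym fa≡max) (≤-maximum f b)

injective⇒surjective : ∀ {m} {f : Fin m → Fin m} → Injective _≡_ _≡_ f → ∀ y → ∃[ x ] f x ≡ y
injective⇒surjective {suc m} {f} f-inj y with any? (λ x → f x ≟ᶠ y)
... | yes hit = hit
... | no miss = contradiction (injective⇒≤ h-inj) (<-irrefl refl)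
  where
  h : Fin (suc m) → Fin m
  h x = punchOut {i = y} {j = f x} (λ y≡fx → miss (x , sym y≡fx))
  h-inj : Injective _≡_ _≡_ h
  h-inj eq = f-inj (punchOut-injective {i = y} _ _ eq)

module Cycles (D : Digraph) where

  DiCycleIn-within : ∀ {S T} (cycle : DiCycleIn D S) → (∀ i → T (DiCycleIn.w cycle i)) →
                     DiCycleIn D T
  DiCycleIn-within cycle w∈T =
    record { k = k ; w = w ; w-inj = w-inj ; w-in = w∈T ; w-arc = w-arc ; w-close = w-close }
    where open DiCycleIn cycle

  acyclic-anti : {S T : VSet D} → S ⊆ T → Acyclic D T → Acyclic D S
  acyclic-anti S⊆T acyclic cycle = acyclic (DiCycleIn-within cycle (S⊆T ∘ DiCycleIn.w-in cycle))

  other-vertex : ∀ {S} → DiCycleIn D S → ∀ v → ∃[ x ] (S x × x ≢ v)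
  other-vertex {S} cycle v =
    one-avoids (w-in fzero) (w-in (fsuc fzero)) (λ w₀≡w₁ → contradiction (w-inj w₀≡w₁) λ ())
    where
    open DiCycleIn cycle
    one-avoids : ∀ {a b} → S a → S b → a ≢ b → ∃[ x ] (S x × x ≢ v)
    one-avoids {a} {b} a∈S b∈S a≢b with a ≟ᶠ v
    ... | no a≢v = a , a∈S , a≢v
    ... | yes refl = b , b∈S , a≢b ∘ sym

  private
    N : ℕ
    N = n D

    IsDiCycle : VSet D → ∀ k → (Fin (suc (suc k)) → Fin N) → Set
    IsDiCycle S k w = (∀ i j → w i ≡ w j → i ≡ j) × (∀ i → S (w i))
                    × (∀ (i : Fin (suc k)) → Arc D (w (inject₁ i)) (w (fsuc i)))
                    × Arc D (w (fromℕ (suc k))) (w fzero)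

    isDiCycle? : ∀ {S} → Decidable S → ∀ k w → Dec (IsDiCycle S k w)
    isDiCycle? S? k w =
      all? (λ i → all? λ j → (w i ≟ᶠ w j) →-dec (i ≟ᶠ j))
      ×-dec all? (S? ∘ w)
      ×-dec all? (λ i → T? (arc D (w (inject₁ i)) (w (fsuc i))))
      ×-dec T? (arc D (w (fromℕ (suc k))) (w fzero))

    IsDiCycle-cong : ∀ {S k w w′} → w ≗ w′ → IsDiCycle S k w → IsDiCycle S k w′
    IsDiCycle-cong {S} {k} {w} {w′} w≗w′ (inj , inS , arcs , closing) =
      (λ i j eq → inj i j (trans (w≗w′ i) (trans eq (sym (w≗w′ j))))) ,
      (λ i → subst S (w≗w′ i) (inS i)) ,
      (λ i → subst-arc (w≗w′ (inject₁ i)) (w≗w′ (fsuc i)) (arcs i)) ,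
      subst-arc (w≗w′ (fromℕ (suc k))) (w≗w′ fzero) closing
      where
      subst-arc : ∀ {a b a′ b′} → a ≡ a′ → b ≡ b′ → Arc D a b → Arc D a′ b′
      subst-arc refl refl arc = arc

    toDiCycle : ∀ {S k w} → IsDiCycle S k w → DiCycleIn D S
    toDiCycle {k = k} {w} (inj , inS , arcs , closing) =
      record { k = k ; w = w ; w-inj = inj _ _ ; w-in = inS ; w-arc = arcs ; w-close = closing }

    fromDiCycle : ∀ {S} → DiCycleIn D S → ∃[ k ] (k < N × ∃[ ws ] IsDiCycle S k (lookup ws))
    fromDiCycle {S} cycle =
      k , ≤-trans (n≤1+n (suc k)) (injective⇒≤ w-inj) , tabulate w ,
      IsDiCycle-cong {S} (sym ∘ lookup∘tabulate w) ((λ _ _ → w-inj) , w-in , w-arc , w-close)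
      where open DiCycleIn cycle

  diCycle? : ∀ {S} → Decidable S → Dec (DiCycleIn D S)
  diCycle? S? = map′ (toDiCycle ∘ proj₂ ∘ proj₂ ∘ proj₂) fromDiCycle
    (anyUpTo? (λ k → any-Vec? _ (isDiCycle? S? k ∘ lookup)) N)

  acyclic? : ∀ {S} → Decidable S → Dec (Acyclic D S)
  acyclic? S? = ¬? (diCycle? S?)

record IsGrundy (D : Digraph) (g : Coloring D) : Set where
  field
    positive      : ∀ v → 1 ≤ g v
    class-acyclic : ∀ v → Acyclic D (λ u → g u ≡ g v)
    forced        : ∀ v i → 1 ≤ i → i < g v → ¬ Acyclic D (λ u → g u ≡ i ⊎ u ≡ v)

module Orderings (D : Digraph) where

  pos : Ordering D → Fin (n D) → ℕ
  pos φ u = toℕ (φ ⟨$⟩ˡ u)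

  pos-injective : ∀ φ {u v} → pos φ u ≡ pos φ v → u ≡ v
  pos-injective φ {u} {v} eq =
    trans (sym (inverseʳ φ)) (trans (cong (φ ⟨$⟩ʳ_) (toℕ-injective eq)) (inverseʳ φ))

  before? : ∀ φ u v → Dec (Before D φ u v)
  before? φ u v = pos φ u <? pos φ v

  before-wellFounded : ∀ φ → WellFounded (Before D φ)
  before-wellFounded φ = On.wellFounded (φ ⟨$⟩ˡ_) <-wellFounded

module Greedy (D : Digraph) where
  open Cycles D
  open Orderings D

  usedBefore? : ∀ φ c i v → Dec (UsedBefore D φ c i v)
  usedBefore? φ c i v = any? λ u → before? φ u v ×-dec (c u ≟ℕ i)

  fresh-class-acyclic : ∀ {φ c i v} → ¬ UsedBefore D φ c i v → Acyclic D (ClassPlus D φ c i v)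
  fresh-class-acyclic {v = v} unused cycle with other-vertex cycle v
  ... | x , inj₁ (x<v , cx≡i) , _ = unused (x , x<v , cx≡i)
  ... | x , inj₂ x≡v , x≢v = x≢v x≡v

  ClassPlus-agree : ∀ {φ c c′ i v} → (∀ {u} → Before D φ u v → c u ≡ c′ u) →
                    ClassPlus D φ c i v ⊆ ClassPlus D φ c′ i v
  ClassPlus-agree c≡c′ (inj₁ (u<v , cu≡i)) = inj₁ (u<v , trans (sym (c≡c′ u<v)) cu≡i)
  ClassPlus-agree c≡c′ (inj₂ u≡v) = inj₂ u≡v

  module _ {φ : Ordering D} {c : Coloring D} (greedy : IsGreedy D φ c) where
    private
      positive : ∀ v → 1 ≤ c v
      positive v = proj₁ (greedy v)

      fits : ∀ v → Acyclic D (ClassPlus D φ c (c v) v)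
      fits v = proj₁ (proj₂ (greedy v))

      forced : ∀ v i → 1 ≤ i → i < c v → ¬ Acyclic D (ClassPlus D φ c i v)
      forced v = proj₂ (proj₂ (greedy v))

    greedy-used-below : ∀ {v i} → 1 ≤ i → i < c v → UsedBefore D φ c i v
    greedy-used-below {v} {i} 1≤i i<cv = decidable-stable (usedBefore? φ c i v)
      (forced v i 1≤i i<cv ∘ fresh-class-acyclic {φ} {c})

    -- The last vertex x of a monochromatic cycle would close it inside V_{c x} ∪ {x}.
    greedy-class-acyclic : ∀ v → Acyclic D (λ u → c u ≡ c v)
    greedy-class-acyclic v cycle = fits x (DiCycleIn-within cycle w∈class)
      where
      open DiCycleIn cycle
      last : ∃[ a ] (∀ b → pos φ (w b) ≤ pos φ (w a))
      last = argmax (pos φ ∘ w)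
      x : Fin (n D)
      x = w (proj₁ last)
      w∈class : ∀ b → ClassPlus D φ c (c x) x (w b)
      w∈class b with w b ≟ᶠ x
      ... | yes wb≡x = inj₂ wb≡x
      ... | no wb≢x = inj₁ (≤∧≢⇒< (proj₂ last b) (wb≢x ∘ pos-injective φ) ,
                            trans (w-in b) (sym (w-in (proj₁ last))))

    greedy-isGrundy : IsGrundy D c
    greedy-isGrundy = record
      { positive = positive
      ; class-acyclic = greedy-class-acyclic
      ; forced = λ v i 1≤i i<cv → forced v i 1≤i i<cv ∘ acyclic-anti
          λ { (inj₁ (_ , cu≡i)) → inj₁ cu≡i ; (inj₂ u≡v) → inj₂ u≡v }
      }

    greedy-isParsimonious : IsParsimonious D φ c
    greedy-isParsimonious v with usedBefore? φ c (c v) v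
    ... | yes used = inj₁ (used , fits v)
    ... | no unused = inj₂ (none-usable , positive v , unused , λ i 1≤i → greedy-used-below 1≤i)
      where
      none-usable : ∀ i → ¬ UsableExisting D φ c i v
      none-usable i ((u , u<v , cu≡i) , acyclic) with <-cmp i (c v)
      ... | tri< i<cv _ _ = forced v i (subst (1 ≤_) cu≡i (positive u)) i<cv acyclic
      ... | tri≈ _ i≡cv _ = unused (u , u<v , trans cu≡i i≡cv)
      ... | tri> _ _ cv<i = forced u (c v) (positive v) (subst (c v <_) (sym cu≡i) cv<i)
              (fresh-class-acyclic {φ} {c} λ (x , x<u , cx≡cv) → unused (x , <-trans x<u u<v , cx≡cv))

    greedy-usesColors : UsesColors D c (maximum c)
    greedy-usesColors = (λ v → positive v , ≤-maximum c v) , every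
      where
      every : ∀ i → 1 ≤ i → i ≤ maximum c → ∃[ v ] c v ≡ i
      every i 1≤i i≤max with maximum-attained c (≤-trans 1≤i i≤max) | i ≟ℕ maximum c
      ... | x , cx≡max | yes i≡max = x , trans cx≡max (sym i≡max)
      ... | x , cx≡max | no i≢max =
            let u , _ , cu≡i = greedy-used-below 1≤i (subst (i <_) (sym cx≡max) (≤∧≢⇒< i≤max i≢max))
            in u , cu≡i

module GreedyConstruction (D : Digraph) (φ : Ordering D) where
  open Cycles D
  open Orderings D
  open Greedy D

  private
    N : ℕ
    N = n D

  FirstFit : Coloring D → Fin N → ℕ → Set
  FirstFit c v j = Acyclic D (ClassPlus D φ c (suc j) v)
                 × ∀ {j′} → j′ < j → ¬ Acyclic D (ClassPlus D φ c (suc j′) v)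

  -- Color 1 + maximum c is still unused, which bounds the search.
  firstFit : ∀ c v → ∃[ j ] FirstFit c v j
  firstFit c v = least-witness fits? (maximum c) (fresh-class-acyclic {φ} {c} λ (u , _ , cu≡1+max) →
                   <-irrefl refl (subst (_≤ maximum c) cu≡1+max (≤-maximum c u)))
    where
    fits? : ∀ j → Dec (Acyclic D (ClassPlus D φ c (suc j) v))
    fits? j = acyclic? λ u → (before? φ u v ×-dec (c u ≟ℕ suc j)) ⊎-dec (u ≟ᶠ v)

  greedyUpTo : ℕ → Coloring D
  greedyUpTo zero u = 0
  greedyUpTo (suc j) u with pos φ u ≟ℕ j
  ... | yes _ = suc (proj₁ (firstFit (greedyUpTo j) u))
  ... | no _ = greedyUpTo j u

  greedyUpTo-at : ∀ {j u} → pos φ u ≡ j →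
                  greedyUpTo (suc j) u ≡ suc (proj₁ (firstFit (greedyUpTo j) u))
  greedyUpTo-at {j} {u} pos≡j with pos φ u ≟ℕ j
  ... | yes _ = refl
  ... | no pos≢j = contradiction pos≡j pos≢j

  greedyUpTo-other : ∀ {j u} → pos φ u ≢ j → greedyUpTo (suc j) u ≡ greedyUpTo j u
  greedyUpTo-other {j} {u} pos≢j with pos φ u ≟ℕ j
  ... | yes pos≡j = contradiction pos≡j pos≢j
  ... | no _ = refl

  greedyUpTo-settled : ∀ m u → pos φ u < m → greedyUpTo m u ≡ greedyUpTo (suc (pos φ u)) u
  greedyUpTo-settled (suc m) u pos<1+m with m≤n⇒m<n∨m≡n (≤-pred pos<1+m)
  ... | inj₁ pos<m = trans (greedyUpTo-other (<⇒≢ pos<m)) (greedyUpTo-settled m u pos<m)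
  ... | inj₂ refl = refl

  greedyColoring : Coloring D
  greedyColoring = greedyUpTo N

  greedyColoring-before : ∀ {u v} → Before D φ u v → greedyUpTo (pos φ v) u ≡ greedyColoring u
  greedyColoring-before {u} {v} u<v =
    trans (greedyUpTo-settled (pos φ v) u u<v) (sym (greedyUpTo-settled N u (toℕ<n _)))

  greedyColoring-isGreedy : IsGreedy D φ greedyColoring
  greedyColoring-isGreedy v =
    subst (1 ≤_) (sym c≡) (s≤s z≤n) ,
    subst (λ i → Acyclic D (ClassPlus D φ greedyColoring i v)) (sym c≡)
      (acyclic-anti (ClassPlus-agree {φ} {greedyColoring} {c₀} λ u<v → sym (greedyColoring-before u<v))
                    (proj₁ first-fit)) ,
    λ { (suc j′) _ i<c → proj₂ first-fit (≤-pred (subst (suc j′ <_) c≡ i<c))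
                           ∘ acyclic-anti (ClassPlus-agree {φ} {c₀} greedyColoring-before) }
    where
    c₀ : Coloring D
    c₀ = greedyUpTo (pos φ v)
    j : ℕ
    j = proj₁ (firstFit c₀ v)
    first-fit : FirstFit c₀ v j
    first-fit = proj₂ (firstFit c₀ v)
    c≡ : greedyColoring v ≡ suc j
    c≡ = trans (greedyUpTo-settled N v (toℕ<n _)) (greedyUpTo-at refl)

module ColorOrder (D : Digraph) (g : Coloring D) where
  open Orderings D

  private
    N : ℕ
    N = n D

  _≺_ : Fin N → Fin N → Set
  a ≺ b = g a < g b ⊎ (g a ≡ g b × a <ᶠ b)

  _≺?_ : ∀ a b → Dec (a ≺ b)
  a ≺? b = (g a <? g b) ⊎-dec ((g a ≟ℕ g b) ×-dec (toℕ a <? toℕ b))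

  ≺-irrefl : ∀ {a} → ¬ a ≺ a
  ≺-irrefl (inj₁ ga<ga) = <-irrefl refl ga<ga
  ≺-irrefl (inj₂ (_ , a<a)) = <-irrefl refl a<a

  ≺-trans : ∀ {a b c} → a ≺ b → b ≺ c → a ≺ c
  ≺-trans (inj₁ ga<gb) (inj₁ gb<gc) = inj₁ (<-trans ga<gb gb<gc)
  ≺-trans {a} (inj₁ ga<gb) (inj₂ (gb≡gc , _)) = inj₁ (subst (g a <_) gb≡gc ga<gb)
  ≺-trans {c = c} (inj₂ (ga≡gb , _)) (inj₁ gb<gc) = inj₁ (subst (_< g c) (sym ga≡gb) gb<gc)
  ≺-trans (inj₂ (ga≡gb , a<b)) (inj₂ (gb≡gc , b<c)) = inj₂ (trans ga≡gb gb≡gc , <-trans a<b b<c)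

  ≺-connex : ∀ {a b} → a ≢ b → a ≺ b ⊎ b ≺ a
  ≺-connex {a} {b} a≢b with <-cmp (g a) (g b) | <-cmp (toℕ a) (toℕ b)
  ... | tri< ga<gb _ _ | _ = inj₁ (inj₁ ga<gb)
  ... | tri> _ _ gb<ga | _ = inj₂ (inj₁ gb<ga)
  ... | tri≈ _ ga≡gb _ | tri< a<b _ _ = inj₁ (inj₂ (ga≡gb , a<b))
  ... | tri≈ _ ga≡gb _ | tri> _ _ b<a = inj₂ (inj₂ (sym ga≡gb , b<a))
  ... | tri≈ _ _ _ | tri≈ _ a≡b _ = contradiction (toℕ-injective a≡b) a≢b

  predecessors : Fin N → Subset N
  predecessors u = tabulate λ x → does (x ≺? u)

  ∈-predecessors⁺ : ∀ {x u} → x ≺ u → x ∈ predecessors u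
  ∈-predecessors⁺ {x} {u} x≺u =
    lookup⇒[]= x _ (trans (lookup∘tabulate _ x) (dec-true (x ≺? u) x≺u))

  ∈-predecessors⁻ : ∀ {x u} → x ∈ predecessors u → x ≺ u
  ∈-predecessors⁻ {x} {u} x∈ = decidable-stable (x ≺? u) λ x⊀u →
    contradiction (trans (sym (dec-false (x ≺? u) x⊀u)) (trans (sym (lookup∘tabulate _ x)) ([]=⇒lookup x∈)))
                  λ ()

  rank : Fin N → ℕ
  rank u = ∣ predecessors u ∣

  rank<N : ∀ u → rank u < N
  rank<N u = subst (rank u <_) (∣⊤∣≡n N)
    (p⊂q⇒∣p∣<∣q∣ ((λ _ → ∈⊤) , u , ∈⊤ , ≺-irrefl ∘ ∈-predecessors⁻))

  rank-mono : ∀ {a b} → a ≺ b → rank a < rank b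
  rank-mono a≺b = p⊂q⇒∣p∣<∣q∣
    ( (λ x∈ → ∈-predecessors⁺ (≺-trans (∈-predecessors⁻ x∈) a≺b))
    , _ , ∈-predecessors⁺ a≺b , ≺-irrefl ∘ ∈-predecessors⁻ )

  rank-injective : ∀ {a b} → rank a ≡ rank b → a ≡ b
  rank-injective {a} {b} ra≡rb with a ≟ᶠ b
  ... | yes a≡b = a≡b
  ... | no a≢b with ≺-connex a≢b
  ...   | inj₁ a≺b = contradiction (rank-mono a≺b) (<-irrefl ra≡rb)
  ...   | inj₂ b≺a = contradiction (rank-mono b≺a) (<-irrefl (sym ra≡rb))

  position : Fin N → Fin N
  position u = fromℕ< (rank<N u)

  position-injective : Injective _≡_ _≡_ position
  position-injective eq = rank-injective
    (trans (sym (toℕ-fromℕ< (rank<N _))) (trans (cong toℕ eq) (toℕ-fromℕ< (rank<N _))))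

  byColor : Ordering D
  byColor = permutation (proj₁ ∘ vertexAt) position
    (λ u → position-injective (proj₂ (vertexAt (position u))))
    (proj₂ ∘ vertexAt)
    where
    vertexAt : ∀ p → ∃[ u ] position u ≡ p
    vertexAt = injective⇒surjective position-injective

  pos-byColor : ∀ u → pos byColor u ≡ rank u
  pos-byColor u = toℕ-fromℕ< (rank<N u)

  byColor-< : ∀ {u v} → g u < g v → Before D byColor u v
  byColor-< {u} {v} gu<gv =
    subst₂ _<_ (sym (pos-byColor u)) (sym (pos-byColor v)) (rank-mono (inj₁ gu<gv))

  byColor-≤ : ∀ {u v} → Before D byColor u v → g u ≤ g v
  byColor-≤ {u} {v} u<v = ≮⇒≥ λ gv<gu →
    <-asym (subst₂ _<_ (pos-byColor u) (pos-byColor v) u<v) (rank-mono (inj₁ gv<gu))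

module GrundyByColor (D : Digraph) (g : Coloring D) (grundy : IsGrundy D g) where
  open Cycles D
  open Orderings D
  open Greedy D
  open ColorOrder D g
  open IsGrundy grundy

  ClassWith : ℕ → Fin (n D) → VSet D
  ClassWith i v u = g u ≡ i ⊎ u ≡ v

  ClassPlus⊆ClassWith : ∀ {i v} → ClassPlus D byColor g i v ⊆ ClassWith i v
  ClassPlus⊆ClassWith (inj₁ (_ , gu≡i)) = inj₁ gu≡i
  ClassPlus⊆ClassWith (inj₂ u≡v) = inj₂ u≡v

  ClassWith⊆ClassPlus : ∀ {i v} → i < g v → ClassWith i v ⊆ ClassPlus D byColor g i v
  ClassWith⊆ClassPlus {v = v} i<gv (inj₁ gu≡i) =
    inj₁ (byColor-< (subst (_< g v) (sym gu≡i) i<gv) , gu≡i)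
  ClassWith⊆ClassPlus _ (inj₂ u≡v) = inj₂ u≡v

  ClassWith-acyclic : ∀ v → Acyclic D (ClassWith (g v) v)
  ClassWith-acyclic v = acyclic-anti (λ { (inj₁ gu≡gv) → gu≡gv ; (inj₂ refl) → refl }) (class-acyclic v)

  byColor-isGreedy : IsGreedy D byColor g
  byColor-isGreedy v =
    positive v ,
    acyclic-anti ClassPlus⊆ClassWith (ClassWith-acyclic v) ,
    λ i 1≤i i<gv → forced v i 1≤i i<gv ∘ acyclic-anti (ClassWith⊆ClassPlus i<gv)

  module _ {c : Coloring D} (parsimonious : IsParsimonious D byColor c) where

    module _ {v} (c≡g : ∀ {u} → Before D byColor u v → c u ≡ g u) where

      cyclic-below : ∀ {i} → 1 ≤ i → i < g v → ¬ Acyclic D (ClassPlus D byColor c i v)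
      cyclic-below {i} 1≤i i<gv = forced v i 1≤i i<gv ∘
        acyclic-anti (ClassPlus-agree {byColor} {g} {c} (λ u<v → sym (c≡g u<v)) ∘ ClassWith⊆ClassPlus i<gv)

      acyclic-at : Acyclic D (ClassPlus D byColor c (g v) v)
      acyclic-at =
        acyclic-anti (ClassPlus⊆ClassWith ∘ ClassPlus-agree {byColor} {c} {g} c≡g) (ClassWith-acyclic v)

      parsimonious-step : c v ≡ g v
      parsimonious-step with parsimonious v | <-cmp (c v) (g v)
      ... | _ | tri≈ _ cv≡gv _ = cv≡gv
      ... | inj₁ ((u , u<v , cu≡cv) , fits) | tri< cv<gv _ _ =
            contradiction fits (cyclic-below (subst (1 ≤_) (trans (sym (c≡g u<v)) cu≡cv) (positive u)) cv<gv)
      ... | inj₂ (_ , 1≤cv , unused , _) | tri< cv<gv _ _ =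
            contradiction (fresh-class-acyclic {byColor} {c} unused) (cyclic-below 1≤cv cv<gv)
      ... | inj₁ ((u , u<v , cu≡cv) , _) | tri> _ _ gv<cv =
            contradiction (byColor-≤ u<v) (<⇒≱ (subst (g v <_) (trans (sym cu≡cv) (c≡g u<v)) gv<cv))
      ... | inj₂ (none-usable , _ , _ , used-below) | tri> _ _ gv<cv =
            contradiction (used-below (g v) (positive v) gv<cv , acyclic-at) (none-usable (g v))

    parsimonious-unique : c ≗ g
    parsimonious-unique =
      All.wfRec (before-wellFounded byColor) 0ℓ (λ v → c v ≡ g v) λ _ → parsimonious-step

module ColorCount (D : Digraph) where

  UsesColors-resp : ∀ {c c′ k} → c ≗ c′ → UsesColors D c k → UsesColors D c′ k
  UsesColors-resp c≗c′ (bounds , every) =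
    (λ v → subst (1 ≤_) (c≗c′ v) (proj₁ (bounds v)) , subst (_≤ _) (c≗c′ v) (proj₂ (bounds v))) ,
    λ i 1≤i i≤k → let v , cv≡i = every i 1≤i i≤k in v , trans (sym (c≗c′ v)) cv≡i

  UsesColors-≤ : ∀ {c k k′} → UsesColors D c k → UsesColors D c k′ → k ≤ k′
  UsesColors-≤ {k = zero} _ _ = z≤n
  UsesColors-≤ {k = suc k} (_ , every) (bounds′ , _) =
    let v , cv≡1+k = every (suc k) (s≤s z≤n) ≤-refl in subst (_≤ _) cv≡1+k (proj₂ (bounds′ v))

  UsesColors-unique : ∀ {c k k′} → UsesColors D c k → UsesColors D c k′ → k ≡ k′
  UsesColors-unique uses uses′ = ≤-antisym (UsesColors-≤ uses uses′) (UsesColors-≤ uses′ uses)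

  UsesColors⇒≤n : ∀ {c k} → UsesColors D c k → k ≤ n D
  UsesColors⇒≤n {c} (_ , every) = injective⇒≤ {f = representative} λ {i} {j} eq →
    toℕ-injective (suc-injective (trans (sym (color i)) (trans (cong c eq) (color j))))
    where
    representative : Fin _ → Fin (n D)
    representative i = proj₁ (every (suc (toℕ i)) (s≤s z≤n) (toℕ<n i))
    color : ∀ i → c (representative i) ≡ suc (toℕ i)
    color i = proj₂ (every (suc (toℕ i)) (s≤s z≤n) (toℕ<n i))

record GrundyNumber (D : Digraph) : Set where
  field
    K        : ℕ
    coloring : Coloring D
    isGrundy : IsGrundy D coloring
    usesK    : UsesColors D coloring K
    maximal  : ∀ {g k} → IsGrundy D g → UsesColors D g k → k ≤ K

module GrundyColorings (D : Digraph) where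
  open Cycles D
  open Greedy D
  open ColorCount D

  private
    N : ℕ
    N = n D

  IsGrundy-resp : ∀ {g g′} → g ≗ g′ → IsGrundy D g → IsGrundy D g′
  IsGrundy-resp {g} {g′} g≗g′ grundy = record
    { positive = λ v → subst (1 ≤_) (g≗g′ v) (positive v)
    ; class-acyclic = λ v →
        acyclic-anti (λ {u} g′u≡g′v → trans (g≗g′ u) (trans g′u≡g′v (sym (g≗g′ v)))) (class-acyclic v)
    ; forced = λ v i 1≤i i<g′v → forced v i 1≤i (subst (i <_) (sym (g≗g′ v)) i<g′v) ∘ acyclic-anti
        λ { {u} (inj₁ gu≡i) → inj₁ (trans (sym (g≗g′ u)) gu≡i) ; (inj₂ u≡v) → inj₂ u≡v }
    }
    where open IsGrundy grundy

  isGrundy? : ∀ g → Dec (IsGrundy D g)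
  isGrundy? g =
    map′ (λ (p , a , f) → record
           { positive = p ; class-acyclic = a ; forced = λ v i 1≤i i<gv → f v {i} i<gv 1≤i })
         (λ grundy → let open IsGrundy grundy in
           positive , class-acyclic , λ v {i} i<gv 1≤i → forced v i 1≤i i<gv)
    (all? (λ v → 1 ≤? g v)
     ×-dec all? (λ v → acyclic? λ u → g u ≟ℕ g v)
     ×-dec all? λ v →
       allUpTo? (λ i → (1 ≤? i) →-dec ¬? (acyclic? λ u → (g u ≟ℕ i) ⊎-dec (u ≟ᶠ v))) (g v))

  usesColors? : ∀ c k → Dec (UsesColors D c k)
  usesColors? c k =
    all? (λ v → (1 ≤? c v) ×-dec (c v ≤? k))
    ×-dec map′ (λ every i 1≤i i≤k → every {i} (s≤s i≤k) 1≤i)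
               (λ every {i} i<1+k 1≤i → every i 1≤i (≤-pred i<1+k))
               (allUpTo? (λ i → (1 ≤? i) →-dec any? λ v → c v ≟ℕ i) (suc k))

  Realizable : ℕ → Set
  Realizable k = ∃[ g ] (IsGrundy D g × UsesColors D g k)

  -- The colors of a realizing coloring are ≤ N, so it suffices to search colorings into Fin (suc N).
  realizable? : ∀ k → Dec (Realizable k)
  realizable? k = map′ (λ (cs , grundy , uses) → colors cs , grundy , uses) as-vector
    (any-Vec? N λ cs → isGrundy? (colors cs) ×-dec usesColors? (colors cs) k)
    where
    colors : Vec (Fin (suc N)) N → Coloring D
    colors cs u = toℕ (lookup cs u)
    as-vector : Realizable k → ∃[ cs ] (IsGrundy D (colors cs) × UsesColors D (colors cs) k)
    as-vector (g , grundy , uses) = cs , IsGrundy-resp g≗ grundy , UsesColors-resp g≗ uses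
      where
      g<1+N : ∀ u → g u < suc N
      g<1+N u = s≤s (≤-trans (proj₂ (proj₁ uses u)) (UsesColors⇒≤n uses))
      cs : Vec (Fin (suc N)) N
      cs = tabulate λ u → fromℕ< (g<1+N u)
      g≗ : g ≗ colors cs
      g≗ u = sym (trans (cong toℕ (lookup∘tabulate _ u)) (toℕ-fromℕ< (g<1+N u)))

  grundyNumber : GrundyNumber D
  grundyNumber =
    let K , (g , grundy , uses) , greatest =
          greatest-witness realizable? N (UsesColors⇒≤n uses₀)
                           (greedy₀ , greedy-isGrundy {Perm.id} isGreedy₀ , uses₀)
    in record
      { K = K ; coloring = g ; isGrundy = grundy ; usesK = uses
      ; maximal = λ grundy′ uses′ → greatest (UsesColors⇒≤n uses′) (_ , grundy′ , uses′)
      }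
    where
    open GreedyConstruction D Perm.id
      renaming (greedyColoring to greedy₀; greedyColoring-isGreedy to isGreedy₀)
    uses₀ : UsesColors D greedy₀ (maximum greedy₀)
    uses₀ = greedy-usesColors {Perm.id} isGreedy₀

mainTheorem3 : (D : Digraph) → Σ ℕ (λ k → IsDigrundy D k × IsDiochromatic D k)
mainTheorem3 D = K , digrundy , diochromatic
  where
  open GrundyNumber (GrundyColorings.grundyNumber D)
  open Greedy D
  open ColorCount D
  open ColorOrder D coloring using (byColor)
  open GrundyByColor D coloring isGrundy

  greedy-≤K : ∀ {φ c k} → IsGreedy D φ c → UsesColors D c k → k ≤ K
  greedy-≤K {φ} greedy = maximal (greedy-isGrundy {φ} greedy)

  digrundy : IsDigrundy D K
  digrundy = (byColor , coloring , byColor-isGreedy , usesK) , λ φ _ _ → greedy-≤K {φ}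

  diochromatic : IsDiochromatic D K
  diochromatic =
    (byColor , (coloring , greedy-isParsimonious {byColor} byColor-isGreedy , usesK) ,
     λ c k parsimonious uses →
       ≤-reflexive (UsesColors-unique usesK (UsesColors-resp (parsimonious-unique parsimonious) uses))) ,
    λ φ k (_ , minimal) →
      let open GreedyConstruction D φ
          uses = greedy-usesColors {φ} greedyColoring-isGreedy
      in ≤-trans (minimal _ _ (greedy-isParsimonious {φ} greedyColoring-isGreedy) uses)
                 (greedy-≤K {φ} greedyColoring-isGreedy uses)
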